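{- Let $q$ be a prime power and $n$ a positive integer with $\gcd(n,q)=1$. Let $\gamma\in\mathbb{Z}/n\mathbb{Z}$ and $n_\gamma=n/\gcd(\gamma,n)$. Then the $q$-cyclotomic coset $c_{n/q}(\gamma)$ is of equal difference if and only if both of the following hold: (i) $\mathrm{rad}(n_\gamma)\mid q-1$; (ii) if $8\mid n_\gamma$, then $q\equiv 1\pmod 4$.
   Context: For $\gamma\in\mathbb{Z}/n\mathbb{Z}$ (with $\gcd(n,q)=1$), the $q$-cyclotomic coset modulo $n$ containing $\gamma$ is $c_{n/q}(\gamma)=\{\gamma,\gamma q,\dots,\gamma q^{\tau-1}\}\subseteq\mathbb{Z}/n\mathbb{Z}$, where the size $\tau=|c_{n/q}(\gamma)|$ is the least positive integer with $\gamma q^\tau\equiv\gamma\pmod n$. The coset is called of equal difference (an equal-difference coset) if $\tau\mid n$ and $c_{n/q}(\gamma)=\{\gamma,\gamma+\frac n\tau,\dots,\gamma+(\tau-1)\frac n\tau\}$ in $\mathbb{Z}/n\mathbb{Z}$; a coset with one element is regarded as of equal difference. Here $\gcd(\gamma,n)$ is computed for any integer representative of $\gamma$ (with $\gcd(0,n)=n$), and $\mathrm{rad}(m)$ denotes the product of the distinct primes dividing $m$ ($\mathrm{rad}(1)=1$). -}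

module Defs where

open import Data.Nat using (ℕ; zero; suc; _+_; _*_; _^_; _≤_; _<_; NonZero; ≢-nonZero)
open import Data.Nat.DivMod using (_%_; _/_)
open import Data.Nat.GCD using (gcd; gcd[m,n]≢0)
open import Data.Nat.Divisibility using (_∣_; _∣?_)
open import Data.Nat.Primality using (Prime; prime?)
open import Data.List using (List; filter; upTo)
open import Data.Nat.ListAction using (product)
open import Data.Product using (Σ; ∃; _×_; ∃-syntax)
open import Data.Sum using (inj₂)
open import Relation.Nullary using (¬_)
open import Relation.Nullary.Decidable using (_×-dec_)
open import Relation.Binary.PropositionalEquality using (_≡_)

IsPrimePower : ℕ → Set
IsPrimePower q = ∃[ p ] ∃[ k ] (Prime p × 1 ≤ k × q ≡ p ^ k)

ModEq : (n : ℕ) → .{{NonZero n}} → ℕ → ℕ → Set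
ModEq n a b = a % n ≡ b % n

IsCosetSize : (n : ℕ) → .{{NonZero n}} → ℕ → ℕ → ℕ → Set
IsCosetSize n q γ τ =
  1 ≤ τ × ModEq n (γ * q ^ τ) γ ×
  (∀ t → 1 ≤ t → t < τ → ¬ ModEq n (γ * q ^ t) γ)

-- c_{n/q}(γ) = {γ q^i : i < τ} is of equal difference: τ ∣ n (n = d τ, so d = n/τ)
-- and, as subsets of ℤ/nℤ, {γ q^i : i < τ} = {γ + j (n/τ) : j < τ}.
EqualDifference : (n : ℕ) → .{{NonZero n}} → ℕ → ℕ → Set
EqualDifference n q γ =
  ∃[ τ ] (IsCosetSize n q γ τ × τ ∣ n ×
    ∃[ d ] (n ≡ d * τ ×
      (∀ i → i < τ → ∃[ j ] (j < τ × ModEq n (γ * q ^ i) (γ + j * d))) ×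
      (∀ j → j < τ → ∃[ i ] (i < τ × ModEq n (γ * q ^ i) (γ + j * d)))))

rad : ℕ → ℕ
rad m = product (filter (λ p → prime? p ×-dec (p ∣? m)) (upTo (suc m)))

nγ : (n : ℕ) → .{{NonZero n}} → ℕ → ℕ
nγ n@(suc _) γ = _/_ n (gcd γ n) {{≢-nonZero (gcd[m,n]≢0 γ n (inj₂ (λ ())))}}

{-# OPTIONS --safe #-}

-- Write g = gcd γ n, n = g m and γ = g γ′, so that m = n_γ and γ′ is a unit modulo m.
-- Cancelling g turns γ q^i ≡ γ + j g d′ (mod n) into γ′ q^i ≡ γ′ + j d′ (mod m): the coset
-- size is the order of q modulo m, and the coset is of equal difference iff the units
-- γ′ q^i run exactly through a progression γ′ + j d′ (j < τ) modulo m.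
--
-- Sufficiency: let e = gcd m (q − 1), s = m / e and q = 1 + e a. Every prime of s divides e,
-- and 4 ∣ e if 4 ∣ s, so lifting the exponent one prime at a time gives q^u = 1 + e u b with
-- b prime to s / u for each u ∣ s; hence q has order s modulo m. Since q ≡ 1 (mod e), the s
-- distinct residues γ′ q^i lie in the s-term progression γ′ + j e and therefore fill it.
--
-- Necessity: γ′ q lies in the progression, so d′ ∣ q − 1. A prime r ∣ m with r ∤ d′ divides
-- τ, so it divides some term γ′ + j d′ with j < r ≤ τ, which is impossible for a unit γ′ q^i.
-- If 8 ∣ m and q ≡ 3 (mod 4), then 4 ∤ d′ and some term is γ′ + 4 (mod 8), forcing
-- q^i ≡ 5 (mod 8), whereas q² ≡ 1 (mod 8) makes every q^i ≡ 1 or q (mod 8).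

module Submission where

open import Defs
open import Data.Nat using (ℕ; _∸_; _<_; NonZero)
open import Data.Nat.DivMod using (_%_)
open import Data.Nat.Divisibility using (_∣_)
open import Data.Nat.Coprimality using (Coprime)
open import Data.Product using (_×_)
open import Function.Bundles using (_⇔_)
open import Relation.Binary.PropositionalEquality using (_≡_)

open import Data.Nat.Base
open import Data.Nat.Properties
open import Data.Nat.Divisibility
open import Data.Nat.DivMod hiding (_mod_)
open import Data.Nat.GCD
open import Data.Nat.Coprimality using (coprime-divisor; coprime-/gcd; coprime-Bézout)
import Data.Nat.Coprimality as Coprimality
open import Data.Nat.Primality
open import Data.Nat.Primality.Factorisation using (factorise; factorisationHasAllPrimeFactors)
open import Data.Nat.Combinatorics using (_C_; nC1≡n; nCk+nC[k+1]≡[n+1]C[k+1])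
open import Data.Nat.ListAction using (product)
open import Data.Nat.ListAction.Properties using (∈⇒∣product)
open import Data.Nat.Induction using (<-rec)
open import Data.Nat.Tactic.RingSolver using (solve-∀)
open import Data.List using (List; []; _∷_; upTo)
open import Data.List.Relation.Unary.All as All using (All; []; _∷_)
open import Data.List.Relation.Unary.All.Properties using (all-filter)
open import Data.List.Relation.Unary.Unique.Propositional using (Unique; []; _∷_)
open import Data.List.Relation.Unary.Unique.Propositional.Properties using (upTo⁺; filter⁺)
open import Data.List.Membership.Propositional.Properties using (∈-filter⁺; ∈-upTo⁺)
open import Data.Fin as Fin using (Fin; toℕ; fromℕ<; punchOut)
open import Data.Fin.Properties
  using (any?; punchOut-injective; toℕ-injective; toℕ<n; toℕ-fromℕ<; injective⇒≤)
open import Data.Product using (∃₂; ∃-syntax; _,_; proj₁; proj₂; map₁)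
open import Data.Sum using (_⊎_; inj₁; inj₂; [_,_]′)
open import Data.Empty using (⊥; ⊥-elim)
open import Function.Base using (_∘_)
open import Function.Bundles using (mk⇔; Equivalence)
open import Function.Definitions using (Injective)
open import Relation.Nullary using (¬_; Dec; yes; no; contradiction)
open import Relation.Nullary.Decidable using (_×-dec_)
open import Relation.Binary.Definitions using (tri<; tri≈; tri>)
open import Relation.Binary.PropositionalEquality
  using (_≢_; refl; sym; trans; cong; subst; subst₂; module ≡-Reasoning)

variable
  c d i j k m n p q r t u w x y z : ℕ

-- Primes, coprimality and the radical

prime⇒2≤ : Prime p → 2 ≤ p
prime⇒2≤ {p} pp = nonTrivial⇒n>1 p {{prime⇒nonTrivial pp}}

∃prime∣ : 2 ≤ n → ∃[ p ] (Prime p × p ∣ n)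
∃prime∣ {n@(suc _)} 2≤n with factorise n
... | record { factors = [] ; isFactorisation = eq } = contradiction (sym eq) (<⇒≢ 2≤n)
... | record { factors = p ∷ ps ; isFactorisation = eq ; factorsPrime = pp ∷ _ } =
  p , pp , divides (product ps) (trans eq (*-comm p (product ps)))

prime∣prime⇒≡ : Prime p → Prime r → r ∣ p → r ≡ p
prime∣prime⇒≡ pp pr r∣p with prime⇒irreducible pp r∣p
... | inj₁ refl = contradiction pr ¬prime[1]
... | inj₂ r≡p  = r≡p

¬common-prime⇒coprime : (∀ {r} → Prime r → r ∣ m → r ∣ n → ⊥) → Coprime m n
¬common-prime⇒coprime {m} {n} h {zero} (0∣m , 0∣n) rewrite 0∣⇒≡0 0∣m | 0∣⇒≡0 0∣n =
  ⊥-elim (h prime[2] (2 ∣0) (2 ∣0))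
¬common-prime⇒coprime h {1} _ = refl
¬common-prime⇒coprime h {suc (suc i)} (i∣m , i∣n) with ∃prime∣ {suc (suc i)} (s≤s (s≤s z≤n))
... | r , pr , r∣i = ⊥-elim (h pr (∣-trans r∣i i∣m) (∣-trans r∣i i∣n))

coprime⇒¬common-prime : Coprime m n → Prime r → r ∣ m → r ∣ n → ⊥
coprime⇒¬common-prime m⊥n pr r∣m r∣n = ¬prime[1] (subst Prime (m⊥n (r∣m , r∣n)) pr)

prime∤⇒coprime : Prime p → ¬ p ∣ n → Coprime p n
prime∤⇒coprime pp p∤n = ¬common-prime⇒coprime λ pr r∣p r∣n →
  p∤n (subst (_∣ _) (prime∣prime⇒≡ pp pr r∣p) r∣n)

prime∣^⇒∣ : ∀ t → Prime p → p ∣ x ^ t → p ∣ x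
prime∣^⇒∣ zero    pp p∣1 = contradiction (subst Prime (∣1⇒≡1 p∣1) pp) ¬prime[1]
prime∣^⇒∣ {x = x} (suc t) pp p∣x^t+1 with euclidsLemma x (x ^ t) pp p∣x^t+1
... | inj₁ p∣x   = p∣x
... | inj₂ p∣x^t = prime∣^⇒∣ t pp p∣x^t

coprime-^ʳ : ∀ t → Coprime m n → Coprime m (n ^ t)
coprime-^ʳ t m⊥n = ¬common-prime⇒coprime λ pr r∣m r∣n^t →
  coprime⇒¬common-prime m⊥n pr r∣m (prime∣^⇒∣ t pr r∣n^t)

coprime-∣ˡ : d ∣ m → Coprime m n → Coprime d n
coprime-∣ˡ d∣m m⊥n = ¬common-prime⇒coprime λ pr r∣d r∣n →
  coprime⇒¬common-prime m⊥n pr (∣-trans r∣d d∣m) r∣n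

∣m+n∣n⇒∣m : d ∣ m + n → d ∣ n → d ∣ m
∣m+n∣n⇒∣m {d} {m} {n} d∣m+n d∣n = ∣m+n∣m⇒∣n (subst (d ∣_) (+-comm m n) d∣m+n) d∣n

distinct-primes∣⇒product∣ : (ps : List ℕ) → Unique ps → All (λ p → Prime p × p ∣ x) ps →
  product ps ∣ x
distinct-primes∣⇒product∣ {x} []       _           _ = 1∣ x
distinct-primes∣⇒product∣ (p ∷ ps) (p∉ps ∷ ps!) ((pp , p∣x) ∷ ps∣x)
  with distinct-primes∣⇒product∣ ps ps! ps∣x
... | divides k x≡kP = subst (p * product ps ∣_) (sym x≡kP) (*-monoˡ-∣ (product ps) p∣k)
  where
  p⊥P : Coprime p (product ps)
  p⊥P = prime∤⇒coprime pp λ p∣P →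
    All.lookup p∉ps (factorisationHasAllPrimeFactors pp p∣P (All.map proj₁ ps∣x)) refl
  p∣k : p ∣ k
  p∣k = coprime-divisor p⊥P (subst (p ∣_) (trans x≡kP (*-comm k (product ps))) p∣x)

rad∣⇔ : .{{NonZero m}} → rad m ∣ x ⇔ (∀ {p} → Prime p → p ∣ m → p ∣ x)
rad∣⇔ {m} {x} = mk⇔ rad∣⇒ ∣⇒rad∣
  where
  P? : ∀ p → Dec (Prime p × p ∣ m)
  P? p = prime? p ×-dec (p ∣? m)
  rad∣⇒ : rad m ∣ x → ∀ {p} → Prime p → p ∣ m → p ∣ x
  rad∣⇒ rad∣x pp p∣m = ∣-trans (∈⇒∣product (∈-filter⁺ P? (∈-upTo⁺ (s≤s (∣⇒≤ p∣m))) (pp , p∣m))) rad∣x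
  ∣⇒rad∣ : (∀ {p} → Prime p → p ∣ m → p ∣ x) → rad m ∣ x
  ∣⇒rad∣ h = distinct-primes∣⇒product∣ _ (filter⁺ P? (upTo⁺ (suc m)))
    (All.map (λ (pp , p∣m) → pp , h pp p∣m) (all-filter P? (upTo (suc m))))

-- Congruences

infix 4 _≡_mod_

-- Defined without _%_, so that every modulus is allowed and proofs are ring identities.

_≡_mod_ : ℕ → ℕ → ℕ → Set
_≡_mod_ x y m = ∃₂ λ k l → x + k * m ≡ y + l * m

mod-refl : x ≡ x mod m
mod-refl = 0 , 0 , refl

mod-sym : x ≡ y mod m → y ≡ x mod m
mod-sym (k , l , eq) = l , k , sym eq

mod-trans : x ≡ y mod m → y ≡ z mod m → x ≡ z mod m
mod-trans {x} {y} {m} {z} (k , l , x≈y) (k′ , l′ , y≈z) = k + k′ , l′ + l , (begin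
  x + (k + k′) * m     ≡⟨ split x k k′ m ⟩
  (x + k * m) + k′ * m ≡⟨ cong (_+ k′ * m) x≈y ⟩
  (y + l * m) + k′ * m ≡⟨ swap y l k′ m ⟩
  (y + k′ * m) + l * m ≡⟨ cong (_+ l * m) y≈z ⟩
  (z + l′ * m) + l * m ≡⟨ split z l′ l m ⟨
  z + (l′ + l) * m     ∎)
  where
  open ≡-Reasoning
  split : ∀ x k k′ m → x + (k + k′) * m ≡ (x + k * m) + k′ * m
  split = solve-∀
  swap : ∀ y l k′ m → (y + l * m) + k′ * m ≡ (y + k′ * m) + l * m
  swap = solve-∀

mod-+ˡ : ∀ c → x ≡ y mod m → c + x ≡ c + y mod m
mod-+ˡ {x} {y} {m} c (k , l , eq) = k , l , (begin
  c + x + k * m   ≡⟨ +-assoc c x (k * m) ⟩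
  c + (x + k * m) ≡⟨ cong (c +_) eq ⟩
  c + (y + l * m) ≡⟨ +-assoc c y (l * m) ⟨
  c + y + l * m   ∎)
  where open ≡-Reasoning

mod-*ʳ : ∀ c → x ≡ y mod m → x * c ≡ y * c mod m
mod-*ʳ {x} {y} {m} c (k , l , eq) = k * c , l * c , (begin
  x * c + k * c * m ≡⟨ distrib x k c m ⟩
  (x + k * m) * c   ≡⟨ cong (_* c) eq ⟩
  (y + l * m) * c   ≡⟨ distrib y l c m ⟨
  y * c + l * c * m ∎)
  where
  open ≡-Reasoning
  distrib : ∀ x k c m → x * c + k * c * m ≡ (x + k * m) * c
  distrib = solve-∀

mod-*ˡ : ∀ c → x ≡ y mod m → c * x ≡ c * y mod m
mod-*ˡ {x} {y} {m} c x≈y = subst₂ (_≡_mod m) (*-comm x c) (*-comm y c) (mod-*ʳ c x≈y)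

mod-* : x ≡ y mod m → u ≡ w mod m → x * u ≡ y * w mod m
mod-* {y = y} {u = u} x≈y u≈w = mod-trans (mod-*ʳ u x≈y) (mod-*ˡ y u≈w)

mod-^ : ∀ t → x ≡ y mod m → x ^ t ≡ y ^ t mod m
mod-^ zero    _   = mod-refl
mod-^ (suc t) x≈y = mod-* x≈y (mod-^ t x≈y)

mod-∣ : d ∣ m → x ≡ y mod m → x ≡ y mod d
mod-∣ {d} {x = x} {y} (divides c refl) (k , l , eq) = k * c , l * c ,
  trans (cong (x +_) (*-assoc k c d)) (trans eq (cong (y +_) (sym (*-assoc l c d))))

x+km≡x : ∀ x k m → x + k * m ≡ x mod m
x+km≡x x k m = 0 , k , +-identityʳ (x + k * m)

∣⇔+≡mod : m ∣ t ⇔ x + t ≡ x mod m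
∣⇔+≡mod {m} {t} {x} = mk⇔ (λ { (divides c refl) → x+km≡x x c m }) ≡mod⇒∣
  where
  ≡mod⇒∣ : x + t ≡ x mod m → m ∣ t
  ≡mod⇒∣ (k , l , eq) = ∣m+n∣m⇒∣n (subst (m ∣_) lm≡km+t (n∣m*n l)) (n∣m*n k)
    where
    lm≡km+t : l * m ≡ k * m + t
    lm≡km+t = +-cancelˡ-≡ x _ _
      (trans (sym eq) (trans (+-assoc x t (k * m)) (cong (x +_) (+-comm t (k * m)))))

∣⇔≡0 : m ∣ t ⇔ t ≡ 0 mod m
∣⇔≡0 = ∣⇔+≡mod {x = 0}

∣∸⇔≡mod : y ≤ x → m ∣ x ∸ y ⇔ x ≡ y mod m
∣∸⇔≡mod {y} {x} {m} y≤x = subst (λ x′ → m ∣ x′ ∸ y ⇔ x′ ≡ y mod m) (m+[n∸m]≡n y≤x)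
  (subst (λ t → m ∣ t ⇔ y + (x ∸ y) ≡ y mod m) (sym (m+n∸m≡n y (x ∸ y))) ∣⇔+≡mod)

mod-cancelˡ : Coprime m c → c * x ≡ c * y mod m → x ≡ y mod m
mod-cancelˡ {m} {c} {x} {y} m⊥c cx≈cy =
  [ (λ y≤x → cancel y≤x cx≈cy) , (λ x≤y → mod-sym (cancel x≤y (mod-sym cx≈cy))) ]′ (≤-total y x)
  where
  cancel : ∀ {x y} → y ≤ x → c * x ≡ c * y mod m → x ≡ y mod m
  cancel {x} {y} y≤x cx≈cy = Equivalence.to (∣∸⇔≡mod y≤x) (coprime-divisor m⊥c
    (subst (m ∣_) (sym (*-distribˡ-∸ c x y)) (Equivalence.from (∣∸⇔≡mod (*-monoʳ-≤ c y≤x)) cx≈cy)))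

mod-scale : ∀ g .{{_ : NonZero g}} → g * x ≡ g * y mod (g * m) ⇔ x ≡ y mod m
mod-scale {x} {y} {m} g = mk⇔ unscale scale
  where
  factor : ∀ g x k m → g * x + k * (g * m) ≡ g * (x + k * m)
  factor = solve-∀
  unscale : g * x ≡ g * y mod (g * m) → x ≡ y mod m
  unscale (k , l , eq) =
    k , l , *-cancelˡ-≡ _ _ g (trans (sym (factor g x k m)) (trans eq (factor g y l m)))
  scale : x ≡ y mod m → g * x ≡ g * y mod (g * m)
  scale (k , l , eq) = k , l , trans (factor g x k m) (trans (cong (g *_) eq) (sym (factor g y l m)))

ModEq⇔≡mod : .{{_ : NonZero m}} → ModEq m x y ⇔ x ≡ y mod m
ModEq⇔≡mod {m} {x} {y} = mk⇔ ModEq⇒≡mod ≡mod⇒ModEq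
  where
  open ≡-Reasoning
  ModEq⇒≡mod : ModEq m x y → x ≡ y mod m
  ModEq⇒≡mod x%m≡y%m = y / m , x / m , (begin
    x + y / m * m               ≡⟨ cong (_+ y / m * m) (m≡m%n+[m/n]*n x m) ⟩
    x % m + x / m * m + y / m * m ≡⟨ cong (λ r → r + x / m * m + y / m * m) x%m≡y%m ⟩
    y % m + x / m * m + y / m * m ≡⟨ swap (y % m) (x / m * m) (y / m * m) ⟩
    y % m + y / m * m + x / m * m ≡⟨ cong (_+ x / m * m) (m≡m%n+[m/n]*n y m) ⟨
    y + x / m * m               ∎)
    where
    swap : ∀ r a b → r + a + b ≡ r + b + a
    swap = solve-∀
  ≡mod⇒ModEq : x ≡ y mod m → ModEq m x y
  ≡mod⇒ModEq (k , l , eq) = begin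
    x % m           ≡⟨ [m+kn]%n≡m%n x k m ⟨
    (x + k * m) % m ≡⟨ cong (_% m) eq ⟩
    (y + l * m) % m ≡⟨ [m+kn]%n≡m%n y l m ⟩
    y % m           ∎

-- Multiplicative order

IsMultiplicativeOrder : ℕ → ℕ → ℕ → Set
IsMultiplicativeOrder m x s =
  1 ≤ s × (x ^ s ≡ 1 mod m) × (∀ t → 1 ≤ t → t < s → ¬ x ^ t ≡ 1 mod m)

pow≡1-*ˡ : ∀ x t k → x ^ t ≡ 1 mod m → x ^ (k * t) ≡ 1 mod m
pow≡1-*ˡ {m} x t k x^t≡1 =
  subst₂ (_≡_mod m) (trans (^-*-assoc x t k) (cong (x ^_) (*-comm t k))) (^-zeroˡ k) (mod-^ k x^t≡1)

pow≡1-cancel : ∀ x d a → x ^ a ≡ 1 mod m → x ^ (d + a) ≡ 1 mod m → x ^ d ≡ 1 mod m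
pow≡1-cancel {m} x d a x^a≡1 x^[d+a]≡1 = subst (_≡ 1 mod m) (*-identityʳ (x ^ d))
  (mod-trans (mod-sym (mod-*ˡ (x ^ d) x^a≡1)) (subst (_≡ 1 mod m) (^-distribˡ-+-* x d a) x^[d+a]≡1))

pow≡1-gcd : ∀ x a b → x ^ a ≡ 1 mod m → x ^ b ≡ 1 mod m → x ^ gcd a b ≡ 1 mod m
pow≡1-gcd {m} x a b x^a≡1 x^b≡1 with Bézout.identity (gcd-GCD a b)
... | Bézout.+- i j eq = pow≡1-cancel x (gcd a b) (j * b) (pow≡1-*ˡ x b j x^b≡1)
  (subst (λ e → x ^ e ≡ 1 mod m) (sym eq) (pow≡1-*ˡ x a i x^a≡1))
... | Bézout.-+ i j eq = pow≡1-cancel x (gcd a b) (i * a) (pow≡1-*ˡ x a i x^a≡1)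
  (subst (λ e → x ^ e ≡ 1 mod m) (sym eq) (pow≡1-*ˡ x b j x^b≡1))

isMultiplicativeOrder-byPrimes : ∀ {s} → 1 ≤ s → x ^ s ≡ 1 mod m →
  (∀ {p u} → Prime p → u * p ≡ s → ¬ x ^ u ≡ 1 mod m) → IsMultiplicativeOrder m x s
isMultiplicativeOrder-byPrimes {x = x} {m = m} {s = s} 1≤s x^s≡1 maximal = 1≤s , x^s≡1 , smaller
  where
  smaller : ∀ t → 1 ≤ t → t < s → ¬ x ^ t ≡ 1 mod m
  smaller t@(suc _) _ t<s x^t≡1 with gcd[m,n]∣n t s
  ... | divides zero s≡0 = <⇒≢ 1≤s (sym s≡0)
  ... | divides 1 s≡g = <⇒≢ (≤-<-trans (∣⇒≤ (gcd[m,n]∣m t s)) t<s) (sym (trans s≡g (+-identityʳ _)))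
  ... | divides w@(suc (suc _)) s≡wg with ∃prime∣ {w} (s≤s (s≤s z≤n))
  ... | p , pp , divides w′ w≡w′p =
    maximal {p} {w′ * gcd t s} pp
      (trans (reassoc w′ (gcd t s) p) (sym (trans s≡wg (cong (_* gcd t s) w≡w′p))))
      (pow≡1-*ˡ x (gcd t s) w′ (pow≡1-gcd x t s x^t≡1 x^s≡1))
    where
    reassoc : ∀ w′ g p → w′ * g * p ≡ w′ * p * g
    reassoc = solve-∀

isMultiplicativeOrder⇒pow≢ : ∀ {s} → IsMultiplicativeOrder m x s → Coprime m x →
  i < j → j < s → ¬ x ^ j ≡ x ^ i mod m
isMultiplicativeOrder⇒pow≢ {m = m} {x = x} {i = i} {j = j} (_ , _ , smaller) m⊥x i<j j<s x^j≡x^i =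
  smaller (j ∸ i) (m<n⇒0<n∸m i<j) (≤-<-trans (m∸n≤m j i) j<s) (mod-cancelˡ (coprime-^ʳ i m⊥x)
    (subst₂ (_≡_mod m) x^j≡x^i*x^[j-i] (sym (*-identityʳ (x ^ i))) x^j≡x^i))
  where
  x^j≡x^i*x^[j-i] : x ^ j ≡ x ^ i * x ^ (j ∸ i)
  x^j≡x^i*x^[j-i] = trans (cong (x ^_) (sym (m+[n∸m]≡n (<⇒≤ i<j)))) (^-distribˡ-+-* x i (j ∸ i))

isMultiplicativeOrder⇒pow-injective : ∀ {s} → IsMultiplicativeOrder m x s → Coprime m x →
  i < s → j < s → x ^ i ≡ x ^ j mod m → i ≡ j
isMultiplicativeOrder⇒pow-injective {i = i} {j} ord m⊥x i<s j<s x^i≡x^j with <-cmp i j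
... | tri≈ _ i≡j _ = i≡j
... | tri< i<j _ _ = contradiction (mod-sym x^i≡x^j) (isMultiplicativeOrder⇒pow≢ ord m⊥x i<j j<s)
... | tri> _ _ j<i = contradiction x^i≡x^j (isMultiplicativeOrder⇒pow≢ ord m⊥x j<i i<s)

-- Lifting the exponent

[1+n]C2≡n+nC2 : ∀ n → suc n C 2 ≡ n + n C 2
[1+n]C2≡n+nC2 n = trans (sym (nCk+nC[k+1]≡[n+1]C[k+1] n 1)) (cong (_+ n C 2) (nC1≡n n))

2*[nC2]+n≡n*n : ∀ n → 2 * (n C 2) + n ≡ n * n
2*[nC2]+n≡n*n zero    = refl
2*[nC2]+n≡n*n (suc n) = begin
  2 * (suc n C 2) + suc n         ≡⟨ cong (λ c → 2 * c + suc n) ([1+n]C2≡n+nC2 n) ⟩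
  2 * (n + n C 2) + suc n         ≡⟨ regroup n (n C 2) ⟩
  (2 * (n C 2) + n) + (2 * n + 1) ≡⟨ cong (_+ (2 * n + 1)) (2*[nC2]+n≡n*n n) ⟩
  n * n + (2 * n + 1)             ≡⟨ square n ⟩
  suc n * suc n                   ∎
  where
  open ≡-Reasoning
  regroup : ∀ n c → 2 * (n + c) + suc n ≡ (2 * c + n) + (2 * n + 1)
  regroup = solve-∀
  square : ∀ n → n * n + (2 * n + 1) ≡ suc n * suc n
  square = solve-∀

odd-prime∣pC2 : Prime p → p ≢ 2 → p ∣ p C 2
odd-prime∣pC2 {p} pp p≢2 with euclidsLemma 2 (p C 2) pp p∣2*pC2
  where
  p∣2*pC2 : p ∣ 2 * (p C 2)
  p∣2*pC2 = ∣m+n∣m⇒∣n (subst (p ∣_) (trans (sym (2*[nC2]+n≡n*n p)) (+-comm (2 * (p C 2)) p)) (m∣m*n p))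
    ∣-refl
... | inj₁ p∣2   = contradiction (prime∣prime⇒≡ prime[2] pp p∣2) p≢2
... | inj₂ p∣pC2 = p∣pC2

[1+z]^n-expansion : ∀ z n → ∃[ B ] ((1 + z) ^ n ≡ 1 + n * z + (n C 2) * (z * z) + z * z * z * B)
[1+z]^n-expansion z zero    = 0 , cong suc (sym (*-zeroʳ (z * z * z)))
[1+z]^n-expansion z (suc n) with [1+z]^n-expansion z n
... | B , [1+z]^n≡ = B + n C 2 + z * B , (begin
  (1 + z) * (1 + z) ^ n
    ≡⟨ cong ((1 + z) *_) [1+z]^n≡ ⟩
  (1 + z) * (1 + n * z + (n C 2) * (z * z) + z * z * z * B)
    ≡⟨ expand z n (n C 2) B ⟩
  1 + suc n * z + (n + n C 2) * (z * z) + z * z * z * (B + n C 2 + z * B)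
    ≡⟨ cong (λ c → 1 + suc n * z + c * (z * z) + z * z * z * (B + n C 2 + z * B)) ([1+n]C2≡n+nC2 n) ⟨
  1 + suc n * z + (suc n C 2) * (z * z) + z * z * z * (B + n C 2 + z * B)
    ∎)
  where
  open ≡-Reasoning
  expand : ∀ z n c B → (1 + z) * (1 + n * z + c * (z * z) + z * z * z * B)
                     ≡ 1 + suc n * z + (n + c) * (z * z) + z * z * z * (B + c + z * B)
  expand = solve-∀

-- For odd p the correction E k is a multiple of p E, because p divides p C 2.
[1+pEc]^p-lift : Prime p → ∀ E c →
  ∃[ k ] ((p ≡ 2 ⊎ p ∣ k) × (1 + p * E * c) ^ p ≡ 1 + p * (p * E) * (c + E * k))
[1+pEc]^p-lift {p} pp E c with p ≟ 2
... | yes refl = c * c , inj₁ refl , square E c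
  where
  square : ∀ E c → (1 + 2 * E * c) * ((1 + 2 * E * c) * 1) ≡ 1 + 2 * (2 * E) * (c + E * (c * c))
  square = solve-∀
... | no p≢2 with [1+z]^n-expansion (p * E * c) p | odd-prime∣pC2 pp p≢2
...   | B , expansion | divides h pC2≡hp = k₁ , inj₂ (divides k₁/p refl) , (begin
  (1 + pEc) ^ p
    ≡⟨ expansion ⟩
  1 + p * pEc + (p C 2) * (pEc * pEc) + pEc * pEc * pEc * B
    ≡⟨ cong (λ C → 1 + p * pEc + C * (pEc * pEc) + pEc * pEc * pEc * B) pC2≡hp ⟩
  1 + p * pEc + h * p * (pEc * pEc) + pEc * pEc * pEc * B
    ≡⟨ collect p E c h B ⟩
  1 + p * (p * E) * (c + E * k₁)
    ∎)
  where
  open ≡-Reasoning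
  pEc : ℕ
  pEc = p * E * c
  k₁/p : ℕ
  k₁/p = h * c * c + E * c * c * c * B
  k₁ : ℕ
  k₁ = k₁/p * p
  collect : ∀ p E c h B →
    1 + p * (p * E * c) + h * p * (p * E * c * (p * E * c)) + p * E * c * (p * E * c) * (p * E * c) * B
      ≡ 1 + p * (p * E) * (c + E * ((h * c * c + E * c * c * c * B) * p))
  collect = solve-∀

module LiftingTheExponent {x e a s : ℕ} .{{_ : NonZero e}} .{{_ : NonZero s}}
  (x≡1+ea : x ≡ 1 + e * a) (a⊥s : Coprime a s)
  (primes∣e : ∀ {p} → Prime p → p ∣ s → p ∣ e) (4∣s⇒4∣e : 4 ∣ s → 4 ∣ e) where

  Lifted : ℕ → Set
  Lifted u = ∀ w → u * w ≡ s → ∃[ b ] (x ^ u ≡ 1 + e * u * b × Coprime b w)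

  lift-prime : Prime p → Lifted u → Lifted (u * p)
  lift-prime {p} {u} pp lifted-u w up*w≡s
    with lifted-u (p * w) (trans (sym (*-assoc u p w)) up*w≡s)
       | primes∣e pp (subst (p ∣_) up*w≡s (n∣m*n*o u w))
  ... | b , x^u≡1+eub , b⊥pw | divides e₁ e≡e₁p
    with [1+pEc]^p-lift pp (e₁ * u) b
  ... | k , p≡2⊎p∣k , binomial = b + e₁ * u * k , x^up≡ , b+Ek⊥w
    where
    open ≡-Reasoning
    x^up≡ : x ^ (u * p) ≡ 1 + e * (u * p) * (b + e₁ * u * k)
    x^up≡ = begin
      x ^ (u * p)                         ≡⟨ ^-*-assoc x u p ⟨
      (x ^ u) ^ p                         ≡⟨ cong (_^ p) x^u≡1+eub ⟩
      (1 + e * u * b) ^ p                 ≡⟨ cong (λ e′ → (1 + e′ * u * b) ^ p) e≡e₁p ⟩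
      (1 + e₁ * p * u * b) ^ p            ≡⟨ cong (λ y → (1 + y) ^ p) (regroup e₁ p u b) ⟩
      (1 + p * (e₁ * u) * b) ^ p          ≡⟨ binomial ⟩
      1 + p * (p * (e₁ * u)) * (b + e₁ * u * k)
        ≡⟨ cong (λ y → 1 + y * (b + e₁ * u * k)) (regroup′ e₁ p u) ⟩
      1 + e₁ * p * (u * p) * (b + e₁ * u * k)
        ≡⟨ cong (λ e′ → 1 + e′ * (u * p) * (b + e₁ * u * k)) e≡e₁p ⟨
      1 + e * (u * p) * (b + e₁ * u * k)  ∎
      where
      regroup : ∀ e₁ p u b → e₁ * p * u * b ≡ p * (e₁ * u) * b
      regroup = solve-∀
      regroup′ : ∀ e₁ p u → p * (p * (e₁ * u)) ≡ e₁ * p * (u * p)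
      regroup′ = solve-∀
    p∣Ek : p ∣ w → p ∣ e₁ * u * k
    p∣Ek p∣w = [ p≡2⇒p∣Ek , ∣n⇒∣m*n (e₁ * u) ]′ p≡2⊎p∣k
      where
      p≡2⇒p∣Ek : p ≡ 2 → p ∣ e₁ * u * k
      p≡2⇒p∣Ek p≡2 = subst (_∣ e₁ * u * k) (sym p≡2) (∣m⇒∣m*n k (∣m⇒∣m*n u 2∣e₁))
        where
        4∣s : 4 ∣ s
        4∣s = subst (λ p → p * p ∣ s) p≡2 (subst (p * p ∣_) up*w≡s (*-pres-∣ (n∣m*n u) p∣w))
        2∣e₁ : 2 ∣ e₁
        2∣e₁ = *-cancelʳ-∣ 2 (subst (4 ∣_) (trans e≡e₁p (cong (e₁ *_) p≡2)) (4∣s⇒4∣e 4∣s))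
    r∣Ek : Prime r → r ∣ w → r ∣ e₁ * u * k
    r∣Ek {r} pr r∣w with euclidsLemma e₁ p pr (subst (r ∣_) e≡e₁p (primes∣e pr r∣s))
      where
      r∣s : r ∣ s
      r∣s = subst (r ∣_) up*w≡s (∣n⇒∣m*n (u * p) r∣w)
    ... | inj₁ r∣e₁ = ∣m⇒∣m*n k (∣m⇒∣m*n u r∣e₁)
    ... | inj₂ r∣p with prime∣prime⇒≡ pp pr r∣p
    ...   | refl = p∣Ek r∣w
    b+Ek⊥w : Coprime (b + e₁ * u * k) w
    b+Ek⊥w = ¬common-prime⇒coprime λ pr r∣b+Ek r∣w →
      coprime⇒¬common-prime b⊥pw pr (∣m+n∣n⇒∣m r∣b+Ek (r∣Ek pr r∣w)) (∣n⇒∣m*n p r∣w)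

  lifted : ∀ u → Lifted u
  lifted = <-rec Lifted step
    where
    step : ∀ u → (∀ {u′} → u′ < u → Lifted u′) → Lifted u
    step 0 _ w 0≡s = contradiction (sym 0≡s) (≢-nonZero⁻¹ s)
    step 1 _ w 1*w≡s = a , x^1≡1+e*1*a ,
      Coprimality.sym (coprime-∣ˡ (divides 1 (sym 1*w≡s)) (Coprimality.sym a⊥s))
      where
      x^1≡1+e*1*a : x * 1 ≡ 1 + e * 1 * a
      x^1≡1+e*1*a =
        trans (*-identityʳ x) (trans x≡1+ea (cong (λ e′ → 1 + e′ * a) (sym (*-identityʳ e))))
    step u@(suc (suc _)) rec with ∃prime∣ {u} (s≤s (s≤s z≤n))
    ... | p , pp , divides u′@(suc _) u≡u′p = subst Lifted (sym u≡u′p) (lift-prime pp (rec u′<u))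
      where
      u′<u : u′ < u
      u′<u = subst (u′ <_) (sym u≡u′p) (m<m*n u′ p (prime⇒2≤ pp))

  order : IsMultiplicativeOrder (e * s) x s
  order = isMultiplicativeOrder-byPrimes (>-nonZero⁻¹ s) x^s≡1 (λ {p} {u} → maximal {p} {u})
    where
    x^s≡1 : x ^ s ≡ 1 mod (e * s)
    x^s≡1 with lifted s 1 (*-identityʳ s)
    ... | b , x^s≡1+esb , _ = subst (_≡ 1 mod (e * s))
      (sym (trans x^s≡1+esb (cong (1 +_) (*-comm (e * s) b)))) (x+km≡x 1 b (e * s))
    maximal : Prime p → u * p ≡ s → ¬ x ^ u ≡ 1 mod (e * s)
    maximal {u = zero} _ 0≡s _ = ≢-nonZero⁻¹ s (sym 0≡s)
    maximal {p} {u@(suc _)} pp u*p≡s x^u≡1 with lifted u p u*p≡s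
    ... | b , x^u≡1+eub , b⊥p = coprime⇒¬common-prime b⊥p pp p∣b ∣-refl
      where
      eu*p∣eu*b : e * u * p ∣ e * u * b
      eu*p∣eu*b = subst₂ _∣_
        (trans (cong (e *_) (sym u*p≡s)) (sym (*-assoc e u p))) (cong (_∸ 1) x^u≡1+eub)
        (Equivalence.from (∣∸⇔≡mod (subst (1 ≤_) (sym x^u≡1+eub) (s≤s z≤n))) x^u≡1)
      p∣b : p ∣ b
      p∣b = *-cancelˡ-∣ (e * u) {{m*n≢0 e u}} eu*p∣eu*b

conditions⇒order : .{{_ : NonZero m}} .{{_ : NonZero q}} →
  (∀ {r} → Prime r → r ∣ m → r ∣ q ∸ 1) → (8 ∣ m → q % 4 ≡ 1) →
  ∃₂ λ e s → m ≡ e * s × (q ≡ 1 mod e) × IsMultiplicativeOrder m q s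
conditions⇒order {m} {q} {{m≢0}} primes∣q-1 8∣m⇒q≡1[mod4] =
  e , s , m≡es , q≡1 , subst (λ M → IsMultiplicativeOrder M q s) (sym m≡es) order
  where
  e : ℕ
  e = gcd m (q ∸ 1)
  instance
    e≢0 : NonZero e
    e≢0 = ≢-nonZero (gcd[m,n]≢0 m (q ∸ 1) (inj₁ (≢-nonZero⁻¹ m)))
  s : ℕ
  s = m / e
  a : ℕ
  a = (q ∸ 1) / e
  m≡es : m ≡ e * s
  m≡es = sym (m*[n/m]≡n (gcd[m,n]∣m m (q ∸ 1)))
  instance
    s≢0 : NonZero s
    s≢0 = m*n≢0⇒n≢0 e {{subst NonZero m≡es m≢0}}
  q≡1+ea : q ≡ 1 + e * a
  q≡1+ea = trans (sym (m+[n∸m]≡n (>-nonZero⁻¹ q))) (cong suc (sym (m*[n/m]≡n (gcd[m,n]∣n m (q ∸ 1)))))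
  q≡1 : q ≡ 1 mod e
  q≡1 = subst (_≡ 1 mod e) (sym (trans q≡1+ea (cong suc (*-comm e a)))) (x+km≡x 1 a e)
  s∣m : s ∣ m
  s∣m = divides e m≡es
  primes∣e : Prime p → p ∣ s → p ∣ e
  primes∣e pp p∣s = gcd-greatest (∣-trans p∣s s∣m) (primes∣q-1 pp (∣-trans p∣s s∣m))
  4∣s⇒4∣e : 4 ∣ s → 4 ∣ e
  4∣s⇒4∣e 4∣s = gcd-greatest (∣-trans 4∣s s∣m) 4∣q-1
    where
    8∣m : 8 ∣ m
    8∣m = subst (8 ∣_) (sym m≡es) (*-pres-∣ (primes∣e prime[2] (∣-trans (divides 2 refl) 4∣s)) 4∣s)
    4∣q-1 : 4 ∣ q ∸ 1
    4∣q-1 = divides (q / 4)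
      (cong (_∸ 1) (trans (m≡m%n+[m/n]*n q 4) (cong (_+ q / 4 * 4) (8∣m⇒q≡1[mod4] 8∣m))))
  a⊥s : Coprime a s
  a⊥s = Coprimality.sym (coprime-/gcd m (q ∸ 1))
  open LiftingTheExponent q≡1+ea a⊥s primes∣e 4∣s⇒4∣e using (order)

-- Arithmetic progressions

Fin-injective⇒surjective : ∀ {s} (f : Fin s → Fin s) → Injective _≡_ _≡_ f → ∀ y → ∃[ i ] (f i ≡ y)
Fin-injective⇒surjective f f-injective y with any? (λ i → f i Fin.≟ y)
... | yes hit = hit
Fin-injective⇒surjective {suc s} f f-injective y | no miss =
  contradiction (injective⇒≤ punchOut∘f-injective) 1+n≰n
  where
  f≢y : ∀ i → y ≢ f i
  f≢y i y≡fi = miss (i , sym y≡fi)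
  punchOut∘f-injective : Injective _≡_ _≡_ (λ i → punchOut (f≢y i))
  punchOut∘f-injective eq = f-injective (punchOut-injective (f≢y _) (f≢y _) eq)

<-injective⇒surjective : ∀ {s} (f : ℕ → ℕ) → (∀ i → i < s → f i < s) →
  (∀ {i j} → i < s → j < s → f i ≡ f j → i ≡ j) → ∀ j → j < s → ∃[ i ] (i < s × f i ≡ j)
<-injective⇒surjective {s} f f<s f-injective j j<s =
  let i , Fi≡j = Fin-injective⇒surjective F F-injective (fromℕ< j<s) in
  toℕ i , toℕ<n i , trans (sym (toℕ-F i)) (trans (cong toℕ Fi≡j) (toℕ-fromℕ< j<s))
  where
  F : Fin s → Fin s
  F i = fromℕ< (f<s (toℕ i) (toℕ<n i))
  toℕ-F : ∀ i → toℕ (F i) ≡ f (toℕ i)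
  toℕ-F i = toℕ-fromℕ< (f<s (toℕ i) (toℕ<n i))
  F-injective : Injective _≡_ _≡_ F
  F-injective {i} {i′} Fi≡Fi′ = toℕ-injective
    (f-injective (toℕ<n i) (toℕ<n i′) (trans (sym (toℕ-F i)) (trans (cong toℕ Fi≡Fi′) (toℕ-F i′))))

≡mod⇒progression : ∀ {s e} .{{_ : NonZero s}} → y ≤ x → x ≡ y mod e →
  ∃[ j ] (j < s × x ≡ y + j * e mod (e * s))
≡mod⇒progression {y = y} {x = x} {s = s} {e = e} y≤x x≡y with Equivalence.from (∣∸⇔≡mod y≤x) x≡y
... | divides c x∸y≡ce = c % s , m%n<n c s , 0 , c / s , (begin
  x + 0 * (e * s)                  ≡⟨ +-identityʳ x ⟩
  x                                ≡⟨ m+[n∸m]≡n y≤x ⟨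
  y + (x ∸ y)                      ≡⟨ cong (y +_) x∸y≡ce ⟩
  y + c * e                        ≡⟨ cong (λ c → y + c * e) (m≡m%n+[m/n]*n c s) ⟩
  y + (c % s + c / s * s) * e      ≡⟨ regroup y (c % s) (c / s) s e ⟩
  y + c % s * e + c / s * (e * s)  ∎)
  where
  open ≡-Reasoning
  regroup : ∀ y r k s e → y + (r + k * s) * e ≡ y + r * e + k * (e * s)
  regroup = solve-∀

coprime⇒∃j[r∣c+jd] : .{{_ : NonZero r}} → Coprime r d → ∀ c → ∃[ j ] (j < r × r ∣ c + j * d)
coprime⇒∃j[r∣c+jd] {r@(suc r′)} {d} r⊥d c = j₀ % r , m%n<n j₀ r , ∣m+n∣n⇒∣m r∣c+jd+kdr (n∣m*n (j₀ / r * d))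
  where
  solution : ∃[ j ] (r ∣ c + j * d)
  solution with coprime-Bézout r⊥d
  ... | Bézout.+- x y 1+yd≡xr = c * y , divides (c * x) (begin
    c + c * y * d   ≡⟨ factor c y d ⟩
    c * (1 + y * d) ≡⟨ cong (c *_) 1+yd≡xr ⟩
    c * (x * r)     ≡⟨ *-assoc c x r ⟨
    c * x * r       ∎)
    where
    open ≡-Reasoning
    factor : ∀ c y d → c + c * y * d ≡ c * (1 + y * d)
    factor = solve-∀
  ... | Bézout.-+ x y 1+xr≡yd = c * r′ * y , divides (c + c * r′ * x) (begin
    c + c * r′ * y * d         ≡⟨ reassoc c r′ y d ⟩
    c + c * r′ * (y * d)       ≡⟨ cong (λ t → c + c * r′ * t) 1+xr≡yd ⟨
    c + c * r′ * (1 + x * suc r′) ≡⟨ factor c r′ x ⟩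
    (c + c * r′ * x) * suc r′  ∎)
    where
    open ≡-Reasoning
    reassoc : ∀ c r′ y d → c + c * r′ * y * d ≡ c + c * r′ * (y * d)
    reassoc = solve-∀
    factor : ∀ c r′ x → c + c * r′ * (1 + x * suc r′) ≡ (c + c * r′ * x) * suc r′
    factor = solve-∀
  j₀ : ℕ
  j₀ = proj₁ solution
  r∣c+jd+kdr : r ∣ c + j₀ % r * d + j₀ / r * d * r
  r∣c+jd+kdr = subst (r ∣_)
    (trans (cong (λ j → c + j * d) (m≡m%n+[m/n]*n j₀ r)) (regroup c (j₀ % r) (j₀ / r) r d))
    (proj₂ solution)
    where
    regroup : ∀ c j k r d → c + (j + k * r) * d ≡ c + j * d + k * d * r
    regroup = solve-∀

-- Residues modulo 8

even⊎odd : ∀ n → ∃[ h ] (n ≡ h * 2 ⊎ n ≡ 1 + h * 2)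
even⊎odd zero    = 0 , inj₁ refl
even⊎odd (suc zero) = 0 , inj₂ refl
even⊎odd (suc (suc n)) with even⊎odd n
... | h , inj₁ refl = suc h , inj₁ refl
... | h , inj₂ refl = suc h , inj₂ refl

¬2∣1+h*2 : ∀ h → ¬ 2 ∣ 1 + h * 2
¬2∣1+h*2 h 2∣1+h*2 = contradiction (∣1⇒≡1 (∣m+n∣n⇒∣m 2∣1+h*2 (n∣m*n h))) λ ()

odd⇒coprime-2^ : ∀ t h → Coprime (2 ^ t) (1 + h * 2)
odd⇒coprime-2^ t h = ¬common-prime⇒coprime λ pr r∣2^t r∣odd →
  ¬2∣1+h*2 h (subst (_∣ 1 + h * 2) (prime∣prime⇒≡ prime[2] pr (prime∣^⇒∣ t pr r∣2^t)) r∣odd)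

coprime-to-even⇒odd : 2 ∣ m → Coprime m x → ∃[ h ] (x ≡ 1 + h * 2)
coprime-to-even⇒odd {m} {x} 2∣m m⊥x with even⊎odd x
... | h , inj₁ x≡h*2 =
  contradiction (subst (2 ∣_) (sym x≡h*2) (n∣m*n h)) (coprime⇒¬common-prime m⊥x prime[2] 2∣m)
... | h , inj₂ x≡1+h*2 = h , x≡1+h*2

x²≡1⇒x^i≡1⊎x : x * x ≡ 1 mod m → ∀ i → x ^ i ≡ 1 mod m ⊎ x ^ i ≡ x mod m
x²≡1⇒x^i≡1⊎x x²≡1 zero = inj₁ mod-refl
x²≡1⇒x^i≡1⊎x {x} {m} x²≡1 (suc i) with x²≡1⇒x^i≡1⊎x x²≡1 i
... | inj₁ x^i≡1 = inj₂ (subst (λ y → x * x ^ i ≡ y mod m) (*-identityʳ x) (mod-*ˡ x x^i≡1))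
... | inj₂ x^i≡x = inj₁ (mod-trans (mod-*ˡ x x^i≡x) x²≡1)

[3+h*4]^i≢5[mod8] : ∀ h i → ¬ (3 + h * 4) ^ i ≡ 5 mod 8
[3+h*4]^i≢5[mod8] h i x^i≡5 =
  [ (λ x^i≡1 → 1≢5 (mod-trans (mod-sym x^i≡1) x^i≡5))
  , (λ x^i≡x → x≢5 (mod-trans (mod-sym x^i≡x) x^i≡5))
  ]′ (x²≡1⇒x^i≡1⊎x x²≡1 i)
  where
  expand : ∀ h → (3 + h * 4) * (3 + h * 4) + 0 * 8 ≡ 1 + (1 + 3 * h + 2 * h * h) * 8
  expand = solve-∀
  x²≡1 : (3 + h * 4) * (3 + h * 4) ≡ 1 mod 8
  x²≡1 = 0 , 1 + 3 * h + 2 * h * h , expand h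
  1≢5 : ¬ 1 ≡ 5 mod 8
  1≢5 1≡5 = contradiction (Equivalence.from ModEq⇔≡mod 1≡5) λ ()
  x≢5 : ¬ 3 + h * 4 ≡ 5 mod 8
  x≢5 x≡5 = contradiction (trans (sym ([m+kn]%n≡m%n 3 h 4))
    (Equivalence.from ModEq⇔≡mod (mod-∣ {4} {8} (divides 2 refl) x≡5))) λ ()

-- j = 4 if d is odd (then 8 ∣ t), and j = 2 if d is twice an odd number (then 4 ∣ t).
∃j[j*d≡4[mod8]] : .{{_ : NonZero t}} → 8 ∣ d * t → ¬ 4 ∣ d → ∃[ j ] (j < t × j * d ≡ 4 mod 8)
∃j[j*d≡4[mod8]] {t} {d} 8∣dt 4∤d with even⊎odd d
... | h , inj₂ refl = 4 , 4<t , subst (λ y → y ≡ 4 mod 8) (times4 h) (x+km≡x 4 h 8)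
  where
  4<t : 4 < t
  4<t = <-≤-trans (s≤s (s≤s (s≤s (s≤s (s≤s z≤n))))) (∣⇒≤ (coprime-divisor (odd⇒coprime-2^ 3 h) 8∣dt))
  times4 : ∀ h → 4 + h * 8 ≡ 4 * (1 + h * 2)
  times4 = solve-∀
... | h , inj₁ refl with even⊎odd h
...   | h′ , inj₁ refl = contradiction (divides h′ (*-assoc h′ 2 2)) 4∤d
...   | h′ , inj₂ refl = 2 , 2<t , subst (λ y → y ≡ 4 mod 8) (times2 h′) (x+km≡x 4 h′ 8)
  where
  4∣ht : 4 ∣ (1 + h′ * 2) * t
  4∣ht = *-cancelʳ-∣ 2 (subst (8 ∣_) (*-comm-middle (1 + h′ * 2) 2 t) 8∣dt)
    where
    *-comm-middle : ∀ a b c → a * b * c ≡ a * c * b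
    *-comm-middle = solve-∀
  2<t : 2 < t
  2<t = <-≤-trans (s≤s (s≤s (s≤s z≤n))) (∣⇒≤ (coprime-divisor (odd⇒coprime-2^ 2 h′) 4∣ht))
  times2 : ∀ h′ → 4 + h′ * 8 ≡ 2 * ((1 + h′ * 2) * 2)
  times2 = solve-∀

-- Cyclotomic cosets

module PowersCoverProgression {m q γ′ d′ τ : ℕ} .{{m≢0 : NonZero m}}
  (m⊥γ′ : Coprime m γ′) (m⊥q : Coprime m q) (m≡d′τ : m ≡ d′ * τ) (d′∣q-1 : d′ ∣ q ∸ 1)
  (covers : ∀ j → j < τ → ∃[ i ] (γ′ * q ^ i ≡ γ′ + j * d′ mod m)) where

  instance
    τ≢0 : NonZero τ
    τ≢0 = m*n≢0⇒n≢0 d′ {{subst NonZero m≡d′τ m≢0}}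

  prime∤term : Prime r → r ∣ m → j < τ → ¬ r ∣ γ′ + j * d′
  prime∤term {r} {j} pr r∣m j<τ r∣term with covers j j<τ
  ... | i , γ′q^i≡term with euclidsLemma γ′ (q ^ i) pr r∣γ′q^i
    where
    r∣γ′q^i : r ∣ γ′ * q ^ i
    r∣γ′q^i = Equivalence.from ∣⇔≡0 (mod-trans (mod-∣ r∣m γ′q^i≡term) (Equivalence.to ∣⇔≡0 r∣term))
  ... | inj₁ r∣γ′   = coprime⇒¬common-prime m⊥γ′ pr r∣m r∣γ′
  ... | inj₂ r∣q^i  = coprime⇒¬common-prime m⊥q pr r∣m (prime∣^⇒∣ i pr r∣q^i)

  primes∣q-1 : Prime r → r ∣ m → r ∣ q ∸ 1
  primes∣q-1 {r} pr r∣m with r ∣? d′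
  ... | yes r∣d′ = ∣-trans r∣d′ d′∣q-1
  ... | no  r∤d′ with coprime⇒∃j[r∣c+jd] {{prime⇒nonZero pr}} (prime∤⇒coprime pr r∤d′) γ′
  ...   | j , j<r , r∣term = contradiction r∣term (prime∤term pr r∣m (<-≤-trans j<r (∣⇒≤ r∣τ)))
    where
    r∣τ : r ∣ τ
    r∣τ = [ (λ r∣d′ → contradiction r∣d′ r∤d′) , (λ r∣τ → r∣τ) ]′
      (euclidsLemma d′ τ pr (subst (r ∣_) m≡d′τ r∣m))

  q≡3+h*4⇒4∤d′ : ∀ h → q ≡ 3 + h * 4 → ¬ 4 ∣ d′
  q≡3+h*4⇒4∤d′ h q≡3+h*4 4∣d′ = contradiction (∣⇒≤ (∣m+n∣n⇒∣m 4∣2+h*4 (n∣m*n h))) λ { (s≤s (s≤s ())) }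
    where
    4∣2+h*4 : 4 ∣ 2 + h * 4
    4∣2+h*4 = subst (λ q → 4 ∣ q ∸ 1) q≡3+h*4 (∣-trans 4∣d′ d′∣q-1)

  ∃q^i≡5[mod8] : 8 ∣ m → ¬ 4 ∣ d′ → ∃[ i ] (q ^ i ≡ 5 mod 8)
  ∃q^i≡5[mod8] 8∣m 4∤d′
    with ∃j[j*d≡4[mod8]] (subst (8 ∣_) m≡d′τ 8∣m) 4∤d′
       | coprime-to-even⇒odd (∣-trans (divides 4 refl) 8∣m) m⊥γ′
  ... | j , j<τ , jd′≡4 | g , γ′≡1+g*2 with covers j j<τ
  ...   | i , γ′q^i≡γ′+jd′ =
    i , mod-cancelˡ 8⊥γ′ (mod-trans (mod-∣ 8∣m γ′q^i≡γ′+jd′) (mod-trans (mod-+ˡ γ′ jd′≡4) γ′+4≡γ′*5))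
    where
    8⊥γ′ : Coprime 8 γ′
    8⊥γ′ = subst (Coprime 8) (sym γ′≡1+g*2) (odd⇒coprime-2^ 3 g)
    times5 : ∀ g → 1 + g * 2 + 4 + g * 8 ≡ (1 + g * 2) * 5
    times5 = solve-∀
    γ′+4≡γ′*5 : γ′ + 4 ≡ γ′ * 5 mod 8
    γ′+4≡γ′*5 = mod-sym (subst (λ y → y ≡ γ′ + 4 mod 8)
      (trans (cong (λ γ′ → γ′ + 4 + g * 8) γ′≡1+g*2) (trans (times5 g) (cong (_* 5) (sym γ′≡1+g*2))))
      (x+km≡x (γ′ + 4) g 8))

  8∣m⇒q≡1[mod4] : 8 ∣ m → q % 4 ≡ 1
  8∣m⇒q≡1[mod4] 8∣m with coprime-to-even⇒odd (∣-trans (divides 4 refl) 8∣m) m⊥q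
  ... | h , q≡1+h*2 with even⊎odd h
  ...   | h′ , inj₁ h≡h′*2 =
    trans (cong (_% 4) q≡1+h′*4) ([m+kn]%n≡m%n 1 h′ 4)
    where
    q≡1+h′*4 : q ≡ 1 + h′ * 4
    q≡1+h′*4 = trans q≡1+h*2 (trans (cong (λ h → 1 + h * 2) h≡h′*2) (cong (1 +_) (*-assoc h′ 2 2)))
  ...   | h′ , inj₂ h≡1+h′*2 =
    let i , q^i≡5 = ∃q^i≡5[mod8] 8∣m (q≡3+h*4⇒4∤d′ h′ q≡3+h′*4) in
    contradiction (subst (λ q → q ^ i ≡ 5 mod 8) q≡3+h′*4 q^i≡5) ([3+h*4]^i≢5[mod8] h′ i)
    where
    regroup : ∀ h′ → 1 + (1 + h′ * 2) * 2 ≡ 3 + h′ * 4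
    regroup = solve-∀
    q≡3+h′*4 : q ≡ 3 + h′ * 4
    q≡3+h′*4 = trans q≡1+h*2 (trans (cong (λ h → 1 + h * 2) h≡1+h′*2) (regroup h′))

module Coset {q n γ g m γ′ : ℕ} .{{_ : NonZero n}} .{{_ : NonZero g}}
  (n≡gm : n ≡ g * m) (γ≡gγ′ : γ ≡ g * γ′) (m⊥γ′ : Coprime m γ′) where

  ModEq-scaled : ModEq n (g * x) (g * y) ⇔ x ≡ y mod m
  ModEq-scaled {x} {y} = mk⇔
    (Equivalence.to (mod-scale g) ∘ subst (g * x ≡ g * y mod_) n≡gm ∘ Equivalence.to ModEq⇔≡mod)
    (Equivalence.from ModEq⇔≡mod ∘ subst (g * x ≡ g * y mod_) (sym n≡gm) ∘ Equivalence.from (mod-scale g))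

  γx≡g[γ′x] : ∀ x → γ * x ≡ g * (γ′ * x)
  γx≡g[γ′x] x = trans (cong (_* x) γ≡gγ′) (*-assoc g γ′ x)

  γx≡γ+jgd⇔ : ∀ x j d → ModEq n (γ * x) (γ + j * (g * d)) ⇔ γ′ * x ≡ γ′ + j * d mod m
  γx≡γ+jgd⇔ x j d = subst₂ (λ a b → ModEq n a b ⇔ γ′ * x ≡ γ′ + j * d mod m)
    (sym (γx≡g[γ′x] x)) (sym γ+jgd≡) ModEq-scaled
    where
    factor : ∀ g γ′ j d → g * γ′ + j * (g * d) ≡ g * (γ′ + j * d)
    factor = solve-∀
    γ+jgd≡ : γ + j * (g * d) ≡ g * (γ′ + j * d)
    γ+jgd≡ = trans (cong (λ γ → γ + j * (g * d)) γ≡gγ′) (factor g γ′ j d)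

  γx≡γ⇔ : ModEq n (γ * x) γ ⇔ x ≡ 1 mod m
  γx≡γ⇔ {x} = subst₂ (λ a b → ModEq n a b ⇔ x ≡ 1 mod m) (sym (γx≡g[γ′x] x))
    (sym (trans (sym (*-identityʳ γ)) (γx≡g[γ′x] 1)))
    (mk⇔ (mod-cancelˡ m⊥γ′ ∘ Equivalence.to ModEq-scaled) (Equivalence.from ModEq-scaled ∘ mod-*ˡ γ′))

  isCosetSize : ∀ {s} → IsMultiplicativeOrder m q s → IsCosetSize n q γ s
  isCosetSize (1≤s , q^s≡1 , smaller) =
    1≤s , Equivalence.from γx≡γ⇔ q^s≡1 , λ t 1≤t t<s → smaller t 1≤t t<s ∘ Equivalence.to γx≡γ⇔

  order⇒equalDifference : .{{_ : NonZero q}} → ∀ {e s} → Coprime m q → m ≡ e * s → q ≡ 1 mod e →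
    IsMultiplicativeOrder m q s → EqualDifference n q γ
  order⇒equalDifference {e} {s} m⊥q m≡es q≡1 order@(1≤s , _) =
    s , isCosetSize order , divides (g * e) n≡ges , g * e , n≡ges ,
    (λ i _ → index i , index<s i , ModEq-index i) , hit
    where
    instance
      s≢0 : NonZero s
      s≢0 = >-nonZero 1≤s
    n≡ges : n ≡ g * e * s
    n≡ges = trans n≡gm (trans (cong (g *_) m≡es) (sym (*-assoc g e s)))
    progression : ∀ i → ∃[ j ] (j < s × γ′ * q ^ i ≡ γ′ + j * e mod m)
    progression i = subst (λ M → ∃[ j ] (j < s × γ′ * q ^ i ≡ γ′ + j * e mod M)) (sym m≡es)
      (≡mod⇒progression (m≤m*n γ′ (q ^ i) {{m^n≢0 q i}})
        (subst (λ y → γ′ * q ^ i ≡ y mod e) (*-identityʳ γ′)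
          (mod-*ˡ γ′ (subst (λ y → q ^ i ≡ y mod e) (^-zeroˡ i) (mod-^ i q≡1)))))
    index : ℕ → ℕ
    index i = proj₁ (progression i)
    index<s : ∀ i → index i < s
    index<s i = proj₁ (proj₂ (progression i))
    γ′q^i≡ : ∀ i → γ′ * q ^ i ≡ γ′ + index i * e mod m
    γ′q^i≡ i = proj₂ (proj₂ (progression i))
    ModEq-index : ∀ i → ModEq n (γ * q ^ i) (γ + index i * (g * e))
    ModEq-index i = Equivalence.from (γx≡γ+jgd⇔ (q ^ i) (index i) e) (γ′q^i≡ i)
    index-injective : i < s → j < s → index i ≡ index j → i ≡ j
    index-injective {i} {j} i<s j<s index-i≡index-j =
      isMultiplicativeOrder⇒pow-injective order m⊥q i<s j<s (mod-cancelˡ m⊥γ′ (mod-trans (γ′q^i≡ i)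
        (subst (λ k → γ′ + k * e ≡ γ′ * q ^ j mod m) (sym index-i≡index-j) (mod-sym (γ′q^i≡ j)))))
    hit : ∀ j → j < s → ∃[ i ] (i < s × ModEq n (γ * q ^ i) (γ + j * (g * e)))
    hit j j<s =
      let i , i<s , index-i≡j = <-injective⇒surjective index (λ i _ → index<s i) index-injective j j<s in
      i , i<s , subst (λ j → ModEq n (γ * q ^ i) (γ + j * (g * e))) index-i≡j (ModEq-index i)

  module Necessity .{{_ : NonZero q}} .{{_ : NonZero m}} (m⊥q : Coprime m q)
    {τ d : ℕ} (1≤τ : 1 ≤ τ) (γq^τ≡γ : ModEq n (γ * q ^ τ) γ) (n≡dτ : n ≡ d * τ)
    (powers-in : ∀ i → i < τ → ∃[ j ] (j < τ × ModEq n (γ * q ^ i) (γ + j * d)))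
    (progression-in : ∀ j → j < τ → ∃[ i ] (i < τ × ModEq n (γ * q ^ i) (γ + j * d))) where

    γ+d∈coset : ∃[ i ] ModEq n (γ * q ^ i) (γ + d)
    γ+d∈coset with m≤n⇒m<n∨m≡n 1≤τ
    ... | inj₁ 1<τ = let i , _ , γq^i≡γ+1d = progression-in 1 1<τ in
      i , subst (λ y → ModEq n (γ * q ^ i) (γ + y)) (*-identityˡ d) γq^i≡γ+1d
    ... | inj₂ 1≡τ = 0 , trans (cong (_% n) (*-identityʳ γ))
      (sym (trans (cong (λ d → (γ + d) % n) d≡n) ([m+n]%n≡m%n γ n)))
      where
      d≡n : d ≡ n
      d≡n = sym (trans n≡dτ (trans (cong (d *_) (sym 1≡τ)) (*-identityʳ d)))

    γq∈progression : ∃[ j ] ModEq n (γ * q ^ 1) (γ + j * d)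
    γq∈progression with m≤n⇒m<n∨m≡n 1≤τ
    ... | inj₁ 1<τ = let j , _ , γq≡γ+jd = powers-in 1 1<τ in j , γq≡γ+jd
    ... | inj₂ 1≡τ = 0 , subst (ModEq n (γ * q ^ 1)) (sym (+-identityʳ γ))
      (subst (λ t → ModEq n (γ * q ^ t) γ) (sym 1≡τ) γq^τ≡γ)

    g∣d : g ∣ d
    g∣d = ∣m+n∣m⇒∣n (Equivalence.from ∣⇔≡0 (mod-trans (mod-sym (mod-∣ g∣n γq^i≡γ+d))
      (Equivalence.to ∣⇔≡0 (∣m⇒∣m*n (q ^ proj₁ γ+d∈coset) g∣γ)))) g∣γ
      where
      g∣γ : g ∣ γ
      g∣γ = divides γ′ (trans γ≡gγ′ (*-comm g γ′))
      g∣n : g ∣ n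
      g∣n = divides m (trans n≡gm (*-comm g m))
      γq^i≡γ+d : γ * q ^ proj₁ γ+d∈coset ≡ γ + d mod n
      γq^i≡γ+d = Equivalence.to ModEq⇔≡mod (proj₂ γ+d∈coset)

    d′ : ℕ
    d′ = quotient g∣d

    d≡gd′ : d ≡ g * d′
    d≡gd′ = m∣n⇒n≡m*quotient g∣d

    m≡d′τ : m ≡ d′ * τ
    m≡d′τ = *-cancelˡ-≡ m (d′ * τ) g
      (trans (sym n≡gm) (trans n≡dτ (trans (cong (_* τ) d≡gd′) (*-assoc g d′ τ))))

    reduce : ∀ i j → ModEq n (γ * q ^ i) (γ + j * d) → γ′ * q ^ i ≡ γ′ + j * d′ mod m
    reduce i j =
      Equivalence.to (γx≡γ+jgd⇔ (q ^ i) j d′) ∘ subst (λ d → ModEq n (γ * q ^ i) (γ + j * d)) d≡gd′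

    d′∣q-1 : d′ ∣ q ∸ 1
    d′∣q-1 = subst (λ x → d′ ∣ x ∸ 1) (*-identityʳ q)
      (Equivalence.from (∣∸⇔≡mod (m^n>0 q 1)) (mod-cancelˡ (coprime-∣ˡ d′∣m m⊥γ′) γ′q≡γ′))
      where
      d′∣m : d′ ∣ m
      d′∣m = divides τ (trans m≡d′τ (*-comm d′ τ))
      j₁ : ℕ
      j₁ = proj₁ γq∈progression
      γ′q≡γ′ : γ′ * q ^ 1 ≡ γ′ * 1 mod d′
      γ′q≡γ′ = mod-trans (mod-∣ d′∣m (reduce 1 j₁ (proj₂ γq∈progression)))
        (subst (λ y → γ′ + j₁ * d′ ≡ y mod d′) (sym (*-identityʳ γ′)) (x+km≡x γ′ j₁ d′))

    covers : ∀ j → j < τ → ∃[ i ] (γ′ * q ^ i ≡ γ′ + j * d′ mod m)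
    covers j j<τ = let i , _ , γq^i≡γ+jd = progression-in j j<τ in i , reduce i j γq^i≡γ+jd

    open PowersCoverProgression m⊥γ′ m⊥q m≡d′τ d′∣q-1 covers public using (primes∣q-1; 8∣m⇒q≡1[mod4])

  equalDifference⇒conditions : .{{_ : NonZero q}} .{{_ : NonZero m}} → Coprime m q →
    EqualDifference n q γ → (∀ {r} → Prime r → r ∣ m → r ∣ q ∸ 1) × (8 ∣ m → q % 4 ≡ 1)
  equalDifference⇒conditions m⊥q (_ , (1≤τ , γq^τ≡γ , _) , _ , _ , n≡dτ , powers-in , progression-in) =
    primes∣q-1 , 8∣m⇒q≡1[mod4]
    where open Necessity m⊥q 1≤τ γq^τ≡γ n≡dτ powers-in progression-in

gcd≢0ʳ : ∀ m n .{{_ : NonZero n}} → NonZero (gcd m n)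
gcd≢0ʳ m n = ≢-nonZero (gcd[m,n]≢0 m n (inj₂ (≢-nonZero⁻¹ n)))

nγ-factorisation : ∀ n .{{_ : NonZero n}} γ →
  ∃[ γ′ ] (n ≡ gcd γ n * nγ n γ × γ ≡ gcd γ n * γ′ × Coprime (nγ n γ) γ′)
nγ-factorisation n@(suc _) γ =
  γ / gcd γ n , sym (m*[n/m]≡n (gcd[m,n]∣n γ n)) , sym (m*[n/m]≡n (gcd[m,n]∣m γ n)) ,
  Coprimality.sym (coprime-/gcd γ n)
  where
  instance
    g≢0 : NonZero (gcd γ n)
    g≢0 = gcd≢0ʳ γ n

primePower≢0 : IsPrimePower q → NonZero q
primePower≢0 (p , k , pp , _ , refl) = m^n≢0 p k {{prime⇒nonZero pp}}

theorem3p1 : (q n : ℕ) → .{{_ : NonZero n}} → IsPrimePower q → Coprime n q →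
    (γ : ℕ) → γ < n →
    EqualDifference n q γ ⇔ (rad (nγ n γ) ∣ q ∸ 1 × (8 ∣ nγ n γ → q % 4 ≡ 1))
theorem3p1 q n {{n≢0}} q-primePower n⊥q γ _ with nγ-factorisation n γ
... | γ′ , n≡gm , γ≡gγ′ , m⊥γ′ = mk⇔ necessary sufficient
  where
  instance
    g≢0 : NonZero (gcd γ n)
    g≢0 = gcd≢0ʳ γ n
    q≢0 : NonZero q
    q≢0 = primePower≢0 q-primePower
    m≢0 : NonZero (nγ n γ)
    m≢0 = m*n≢0⇒n≢0 (gcd γ n) {{subst NonZero n≡gm n≢0}}
  m⊥q : Coprime (nγ n γ) q
  m⊥q = coprime-∣ˡ (divides (gcd γ n) n≡gm) n⊥q
  open Coset {g = gcd γ n} {γ′ = γ′} n≡gm γ≡gγ′ m⊥γ′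
  necessary : EqualDifference n q γ → rad (nγ n γ) ∣ q ∸ 1 × (8 ∣ nγ n γ → q % 4 ≡ 1)
  necessary = map₁ (Equivalence.from rad∣⇔) ∘ equalDifference⇒conditions m⊥q
  sufficient : rad (nγ n γ) ∣ q ∸ 1 × (8 ∣ nγ n γ → q % 4 ≡ 1) → EqualDifference n q γ
  sufficient (rad∣q-1 , 8∣m⇒q≡1[mod4]) =
    let _ , _ , m≡es , q≡1 , order =
          conditions⇒order {nγ n γ} {q} (Equivalence.to rad∣⇔ rad∣q-1) 8∣m⇒q≡1[mod4]
    in order⇒equalDifference m⊥q m≡es q≡1 order
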